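{- Let $t$ be a positive integer and $\sqrt{ -t} = i\sqrt{t}$. Fix complex numbers $\alpha,\beta$ with $\alpha^4 = \sqrt{ -t}+1$ and $\beta^4 = \sqrt{ -t}-1$, define the linear forms $$\xi(x,y) = \sqrt{2}\,\alpha\,(x - \sqrt{ -t}\,y), \qquad \eta(x,y) = \sqrt{2}\,\beta\,(x + \sqrt{ -t}\,y),$$ and write $(-t-1)^{1/4} := \alpha\beta$ (so that $((-t-1)^{1/4})^4 = -t-1$). If $(x_{1} , y_{1})$ and $(x_{2}, y_{2})$ are two pairs of rational integers then $$\frac{\xi(x_{1} , y_{1}) \eta(x_{2} , y_{2})}{(-t-1)^{1/4}}, \qquad \xi(x_{1} , y_{1})^{3} \xi(x_{2} , y_{2}) \qquad \text{and} \qquad \eta(x_{1} , y_{1})^{3} \eta(x_{2} , y_{2})$$ are algebraic integers in the field $\mathbb{Q}(\sqrt{ -t})$. -}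

module Defs where

open import Level using (Level)
open import Data.Nat as ℕ using (ℕ; zero; suc)
open import Data.Integer as ℤ using (ℤ; +_; -[1+_])
open import Data.List using (List; []; _∷_)
open import Data.Product using (Σ; _×_; ∃)
open import Relation.Nullary using (¬_)
open import Algebra.Bundles using (CommutativeRing)
open import Relation.Binary.PropositionalEquality using (_≡_)

module _ {c ℓ : Level} (R : CommutativeRing c ℓ) where
  open CommutativeRing R

  ιℕ : ℕ → Carrier
  ιℕ zero = 0#
  ιℕ (suc n) = 1# + ιℕ n

  ι : ℤ → Carrier
  ι (+ n) = ιℕ n
  ι -[1+ n ] = - ιℕ (suc n)

  cube : Carrier → Carrier
  cube x = x * x * x

  pow4 : Carrier → Carrier
  pow4 x = x * x * x * x

  -- R behaves like ℂ for the algebra in question: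
  -- characteristic zero and no zero divisors
  CharZero : Set ℓ
  CharZero = ∀ n → ¬ (ιℕ (suc n) ≈ 0#)

  NoZeroDivisors : Set (c Level.⊔ ℓ)
  NoZeroDivisors = ∀ a b → a * b ≈ 0# → (¬ (a ≈ 0#) → b ≈ 0#)

  -- evaluation of the monic polynomial  X^n + c_{n-1} X^{n-1} + ... + c_0
  -- whose lower coefficients are given by the list [c_0, ..., c_{n-1}]
  evalMonic : List ℤ → Carrier → Carrier
  evalMonic [] v = 1#
  evalMonic (a ∷ cs) v = ι a + v * evalMonic cs v

  IsAlgebraicInteger : Carrier → Set ℓ
  IsAlgebraicInteger v = Σ (List ℤ) λ cs → evalMonic cs v ≈ 0#

  -- v lies in ℚ(s): v = p + q s with p, q rational,
  -- written with a common nonzero denominator k : k v = m + n s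
  InQuadField : Carrier → Carrier → Set ℓ
  InQuadField s v =
    Σ ℤ λ k → Σ ℤ λ m → Σ ℤ λ n →
      (¬ (k ≡ + 0)) × (ι k * v ≈ ι m + ι n * s)

{-# OPTIONS --safe #-}
module Submission where

-- Everything happens in the order ℤ[s] of ℚ(s), where s² = -(t+1).  By hypothesis
-- r² = 2, α⁴ = s + 1, β⁴ = s - 1 and d·αβ = 1 lie in ℤ[s], as do the linear forms
-- x ∓ s y, and each of the three quantities regroups as a product of these.
-- Every m + n s is a root of X² - 2m X + (m² + (t+1) n²) and lies in ℚ(s).

open import Defs
open import Level using (Level)
open import Data.Nat as ℕ using (ℕ; zero; suc)
open import Data.Integer as ℤ using (ℤ; +_; -[1+_])
import Data.Integer.Properties as ℤ
import Data.Nat.Properties as ℕ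
open import Data.Sign as Sign using ()
open import Data.List using (_∷_; [])
open import Data.Maybe using (Maybe; just; nothing)
open import Data.Product using (_×_; _,_; ∃₂)
open import Relation.Nullary using (yes; no)
open import Relation.Binary.Definitions using (_Respects_)
open import Relation.Binary.PropositionalEquality as ≡ using (_≡_)
open import Algebra.Bundles using (CommutativeRing)
open import Algebra.Solver.Ring.AlmostCommutativeRing
  using (fromCommutativeRing; _-Raw-AlmostCommutative⟶_)
import Algebra.Solver.Ring as RingSolver
import Algebra.Properties.Ring as RingProperties
import Algebra.Properties.AbelianGroup as AbelianGroupProperties
import Algebra.Properties.Monoid.Mult as MonoidMultProperties
import Algebra.Properties.Semiring.Mult as SemiringMultProperties
import Relation.Binary.Reasoning.Setoid as SetoidReasoning

module IntegerEmbedding {c ℓ : Level} (R : CommutativeRing c ℓ) where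
  open CommutativeRing R
  open RingProperties ring using (-‿distribˡ-*; -‿distribʳ-*; -‿involutive; -0#≈0#)
  open AbelianGroupProperties +-abelianGroup using (⁻¹-∙-comm)
  open MonoidMultProperties +-monoid using (×-homo-+) renaming (_×_ to _·_)
  open SemiringMultProperties semiring using (×1-homo-*)
  open SetoidReasoning setoid

  ιℕ≡×1# : ∀ n → ιℕ R n ≡ n · 1#
  ιℕ≡×1# zero    = ≡.refl
  ιℕ≡×1# (suc n) = ≡.cong (λ x → 1# + x) (ιℕ≡×1# n)

  ιℕ-homo-+ : ∀ m n → ιℕ R (m ℕ.+ n) ≈ ιℕ R m + ιℕ R n
  ιℕ-homo-+ m n
    rewrite ιℕ≡×1# (m ℕ.+ n) | ιℕ≡×1# m | ιℕ≡×1# n = ×-homo-+ 1# m n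

  ιℕ-homo-* : ∀ m n → ιℕ R (m ℕ.* n) ≈ ιℕ R m * ιℕ R n
  ιℕ-homo-* m n
    rewrite ιℕ≡×1# (m ℕ.* n) | ιℕ≡×1# m | ιℕ≡×1# n = ×1-homo-* m n

  ι-homo-‿ : ∀ i → ι R (ℤ.- i) ≈ - ι R i
  ι-homo-‿ -[1+ n ]    = sym (-‿involutive _)
  ι-homo-‿ (+ zero)    = sym -0#≈0#
  ι-homo-‿ (+ (suc n)) = refl

  ι-⊖ : ∀ m n → ι R (m ℤ.⊖ n) ≈ ιℕ R m - ιℕ R n
  ι-⊖ m       zero    = sym (trans (+-congˡ -0#≈0#) (+-identityʳ _))
  ι-⊖ zero    (suc n) = sym (+-identityˡ _)
  ι-⊖ (suc m) (suc n) = begin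
    ι R (suc m ℤ.⊖ suc n)        ≡⟨ ≡.cong (ι R) (ℤ.[1+m]⊖[1+n]≡m⊖n m n) ⟩
    ι R (m ℤ.⊖ n)                ≈⟨ ι-⊖ m n ⟩
    a - b                        ≈⟨ +-identityˡ _ ⟨
    0# + (a - b)                 ≈⟨ +-congʳ (-‿inverseʳ 1#) ⟨
    (1# - 1#) + (a - b)          ≈⟨ +-assoc 1# (- 1#) (a - b) ⟩
    1# + (- 1# + (a - b))        ≈⟨ +-congˡ (+-assoc (- 1#) a (- b)) ⟨
    1# + ((- 1# + a) - b)        ≈⟨ +-congˡ (+-congʳ (+-comm (- 1#) a)) ⟩
    1# + ((a - 1#) - b)          ≈⟨ +-congˡ (+-assoc a (- 1#) (- b)) ⟩
    1# + (a + (- 1# - b))        ≈⟨ +-assoc 1# a (- 1# - b) ⟨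
    (1# + a) + (- 1# - b)        ≈⟨ +-congˡ (⁻¹-∙-comm 1# b) ⟩
    (1# + a) - (1# + b)          ∎
    where a = ιℕ R m; b = ιℕ R n

  ι-homo-+ : ∀ i j → ι R (i ℤ.+ j) ≈ ι R i + ι R j
  ι-homo-+ -[1+ m ] -[1+ n ] = begin
    - ιℕ R (suc (suc (m ℕ.+ n)))      ≡⟨ ≡.cong (λ k → - ιℕ R k) (≡.sym (ℕ.+-suc (suc m) n)) ⟩
    - ιℕ R (suc m ℕ.+ suc n)          ≈⟨ -‿cong (ιℕ-homo-+ (suc m) (suc n)) ⟩
    - (ιℕ R (suc m) + ιℕ R (suc n))   ≈⟨ ⁻¹-∙-comm _ _ ⟨
    - ιℕ R (suc m) + - ιℕ R (suc n)   ∎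
  ι-homo-+ -[1+ m ] (+ n)    = trans (ι-⊖ n (suc m)) (+-comm _ _)
  ι-homo-+ (+ m)    -[1+ n ] = ι-⊖ m (suc n)
  ι-homo-+ (+ m)    (+ n)    = ιℕ-homo-+ m n

  ι-+◃ : ∀ n → ι R (Sign.+ ℤ.◃ n) ≈ ιℕ R n
  ι-+◃ n = reflexive (≡.cong (ι R) (ℤ.+◃n≡+n n))

  ι--◃ : ∀ n → ι R (Sign.- ℤ.◃ n) ≈ - ιℕ R n
  ι--◃ n = trans (reflexive (≡.cong (ι R) (ℤ.-◃n≡-n n))) (ι-homo-‿ (+ n))

  ι-homo-* : ∀ i j → ι R (i ℤ.* j) ≈ ι R i * ι R j
  ι-homo-* -[1+ m ] -[1+ n ] = begin
    ι R (Sign.+ ℤ.◃ (suc m ℕ.* suc n))   ≈⟨ ι-+◃ (suc m ℕ.* suc n) ⟩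
    ιℕ R (suc m ℕ.* suc n)               ≈⟨ ιℕ-homo-* (suc m) (suc n) ⟩
    a * b                                ≈⟨ *-congʳ (-‿involutive a) ⟨
    - (- a) * b                          ≈⟨ -‿distribˡ-* (- a) b ⟨
    - (- a * b)                          ≈⟨ -‿distribʳ-* (- a) b ⟩
    - a * - b                            ∎
    where a = ιℕ R (suc m); b = ιℕ R (suc n)
  ι-homo-* -[1+ m ] (+ n) = begin
    ι R (Sign.- ℤ.◃ (suc m ℕ.* n))   ≈⟨ ι--◃ (suc m ℕ.* n) ⟩
    - ιℕ R (suc m ℕ.* n)             ≈⟨ -‿cong (ιℕ-homo-* (suc m) n) ⟩
    - (ιℕ R (suc m) * ιℕ R n)        ≈⟨ -‿distribˡ-* _ _ ⟩
    - ιℕ R (suc m) * ιℕ R n          ∎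
  ι-homo-* (+ m) -[1+ n ] = begin
    ι R (Sign.- ℤ.◃ (m ℕ.* suc n))   ≈⟨ ι--◃ (m ℕ.* suc n) ⟩
    - ιℕ R (m ℕ.* suc n)             ≈⟨ -‿cong (ιℕ-homo-* m (suc n)) ⟩
    - (ιℕ R m * ιℕ R (suc n))        ≈⟨ -‿distribʳ-* _ _ ⟩
    ιℕ R m * - ιℕ R (suc n)          ∎
  ι-homo-* (+ m) (+ n) = trans (ι-+◃ (m ℕ.* n)) (ιℕ-homo-* m n)

  ι-morphism : ℤ.+-*-rawRing -Raw-AlmostCommutative⟶ fromCommutativeRing R
  ι-morphism = record
    { ⟦_⟧    = ι R
    ; +-homo = ι-homo-+
    ; *-homo = ι-homo-*
    ; -‿homo = ι-homo-‿
    ; 0-homo = refl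
    ; 1-homo = +-identityʳ 1#
    }

  ι-weaklyDecidable : ∀ i j → Maybe (ι R i ≈ ι R j)
  ι-weaklyDecidable i j with i ℤ.≟ j
  ... | yes ≡.refl = just refl
  ... | no _       = nothing

  open RingSolver ℤ.+-*-rawRing (fromCommutativeRing R) ι-morphism ι-weaklyDecidable
    using (solve; _:=_; _:+_; _:*_; :-_; con) public

module _ {c ℓ : Level} (R : CommutativeRing c ℓ) where
  open CommutativeRing R
  open IntegerEmbedding R
  open SetoidReasoning setoid

  module QuadraticOrder (t : ℕ) (s : Carrier) (s²≈-T : s * s ≈ - ι R (+ suc t)) where

    T : ℤ
    T = + suc t

    infix 4 _∈ℤ[s]
    _∈ℤ[s] : Carrier → Set ℓ
    v ∈ℤ[s] = ∃₂ λ m n → v ≈ ι R m + ι R n * s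

    ∈ℤ[s]-resp-≈ : _∈ℤ[s] Respects _≈_
    ∈ℤ[s]-resp-≈ u≈v (m , n , u≈m+ns) = m , n , trans (sym u≈v) u≈m+ns

    ι-∈ℤ[s] : ∀ k → ι R k ∈ℤ[s]
    ι-∈ℤ[s] k = k , + 0 , solve 2 (λ k s → k := k :+ con (+ 0) :* s) refl (ι R k) s

    1#-∈ℤ[s] : 1# ∈ℤ[s]
    1#-∈ℤ[s] = ∈ℤ[s]-resp-≈ (+-identityʳ 1#) (ι-∈ℤ[s] (+ 1))

    s-∈ℤ[s] : s ∈ℤ[s]
    s-∈ℤ[s] = + 0 , + 1 , solve 1 (λ s → s := con (+ 0) :+ con (+ 1) :* s) refl s

    -‿∈ℤ[s] : ∀ {u} → u ∈ℤ[s] → - u ∈ℤ[s]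
    -‿∈ℤ[s] {u} (m , n , u≈) = ℤ.- m , ℤ.- n , (begin
      - u                                  ≈⟨ -‿cong u≈ ⟩
      - (ι R m + ι R n * s)                ≈⟨ solve 3 (λ a b s → :- (a :+ b :* s) := :- a :+ :- b :* s)
                                                      refl (ι R m) (ι R n) s ⟩
      - ι R m + - ι R n * s                ≈⟨ +-cong (ι-homo-‿ m) (*-congʳ (ι-homo-‿ n)) ⟨
      ι R (ℤ.- m) + ι R (ℤ.- n) * s        ∎)

    +-∈ℤ[s] : ∀ {u v} → u ∈ℤ[s] → v ∈ℤ[s] → u + v ∈ℤ[s]
    +-∈ℤ[s] {u} {v} (m , n , u≈) (m′ , n′ , v≈) = m ℤ.+ m′ , n ℤ.+ n′ , (begin
      u + v                                      ≈⟨ +-cong u≈ v≈ ⟩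
      (a + b * s) + (a′ + b′ * s)                ≈⟨ solve 5 (λ a b a′ b′ s →
                                                       (a :+ b :* s) :+ (a′ :+ b′ :* s) := (a :+ a′) :+ (b :+ b′) :* s)
                                                       refl a b a′ b′ s ⟩
      (a + a′) + (b + b′) * s                    ≈⟨ +-cong (ι-homo-+ m m′) (*-congʳ (ι-homo-+ n n′)) ⟨
      ι R (m ℤ.+ m′) + ι R (n ℤ.+ n′) * s        ∎)
      where a = ι R m; b = ι R n; a′ = ι R m′; b′ = ι R n′

    *-∈ℤ[s] : ∀ {u v} → u ∈ℤ[s] → v ∈ℤ[s] → u * v ∈ℤ[s]
    *-∈ℤ[s] {u} {v} (m , n , u≈) (m′ , n′ , v≈) =
      m ℤ.* m′ ℤ.+ ℤ.- (T ℤ.* (n ℤ.* n′)) , m ℤ.* n′ ℤ.+ n ℤ.* m′ , (begin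
      u * v                                                ≈⟨ *-cong u≈ v≈ ⟩
      (a + b * s) * (a′ + b′ * s)                          ≈⟨ solve 5 (λ a b a′ b′ s →
                                                                 (a :+ b :* s) :* (a′ :+ b′ :* s)
                                                                 := a :* a′ :+ b :* b′ :* (s :* s) :+ (a :* b′ :+ b :* a′) :* s)
                                                                 refl a b a′ b′ s ⟩
      a * a′ + b * b′ * (s * s) + (a * b′ + b * a′) * s    ≈⟨ +-congʳ (+-congˡ (*-congˡ s²≈-T)) ⟩
      a * a′ + b * b′ * - τ + (a * b′ + b * a′) * s        ≈⟨ +-congʳ (+-congˡ (solve 3 (λ b b′ τ →
                                                                 b :* b′ :* :- τ := :- (τ :* (b :* b′))) refl b b′ τ)) ⟩
      a * a′ + - (τ * (b * b′)) + (a * b′ + b * a′) * s    ≈⟨ +-cong real-part (*-congʳ imaginary-part) ⟨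
      ι R (m ℤ.* m′ ℤ.+ ℤ.- (T ℤ.* (n ℤ.* n′))) + ι R (m ℤ.* n′ ℤ.+ n ℤ.* m′) * s ∎)
      where
      a = ι R m; b = ι R n; a′ = ι R m′; b′ = ι R n′; τ = ι R T
      real-part : ι R (m ℤ.* m′ ℤ.+ ℤ.- (T ℤ.* (n ℤ.* n′))) ≈ a * a′ + - (τ * (b * b′))
      real-part = begin
        ι R (m ℤ.* m′ ℤ.+ ℤ.- (T ℤ.* (n ℤ.* n′)))        ≈⟨ ι-homo-+ (m ℤ.* m′) (ℤ.- (T ℤ.* (n ℤ.* n′))) ⟩
        ι R (m ℤ.* m′) + ι R (ℤ.- (T ℤ.* (n ℤ.* n′)))    ≈⟨ +-congˡ (ι-homo-‿ (T ℤ.* (n ℤ.* n′))) ⟩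
        ι R (m ℤ.* m′) + - ι R (T ℤ.* (n ℤ.* n′))        ≈⟨ +-cong (ι-homo-* m m′)
                                                              (-‿cong (trans (ι-homo-* T (n ℤ.* n′)) (*-congˡ (ι-homo-* n n′)))) ⟩
        a * a′ + - (τ * (b * b′))                        ∎
      imaginary-part : ι R (m ℤ.* n′ ℤ.+ n ℤ.* m′) ≈ a * b′ + b * a′
      imaginary-part = trans (ι-homo-+ (m ℤ.* n′) (n ℤ.* m′)) (+-cong (ι-homo-* m n′) (ι-homo-* n m′))

    evalMonic-cong : ∀ cs {u v} → u ≈ v → evalMonic R cs u ≈ evalMonic R cs v
    evalMonic-cong []       u≈v = refl
    evalMonic-cong (_ ∷ cs) u≈v = +-congˡ (*-cong u≈v (evalMonic-cong cs u≈v))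

    ∈ℤ[s]⇒isAlgebraicInteger : ∀ {v} → v ∈ℤ[s] → IsAlgebraicInteger R v
    ∈ℤ[s]⇒isAlgebraicInteger {v} (m , n , v≈u) = cs , trans (evalMonic-cong cs v≈u) (begin
      ι R (m ℤ.* m ℤ.+ T ℤ.* (n ℤ.* n)) + u * (ι R (ℤ.- (m ℤ.+ m)) + u * 1#)
        ≈⟨ +-cong (trans (ι-homo-+ (m ℤ.* m) (T ℤ.* (n ℤ.* n))) (+-cong (ι-homo-* m m) (trans (ι-homo-* T (n ℤ.* n)) (*-congˡ (ι-homo-* n n)))))
                  (*-congˡ (+-cong (trans (ι-homo-‿ (m ℤ.+ m)) (-‿cong (ι-homo-+ m m))) (*-identityʳ u))) ⟩
      a * a + τ * (b * b) + u * (- (a + a) + u)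
        ≈⟨ solve 4 (λ a b s τ → a :* a :+ τ :* (b :* b) :+ (a :+ b :* s) :* (:- (a :+ a) :+ (a :+ b :* s))
                                := b :* b :* (s :* s :+ τ)) refl a b s τ ⟩
      b * b * (s * s + τ)   ≈⟨ *-congˡ (+-congʳ s²≈-T) ⟩
      b * b * (- τ + τ)     ≈⟨ *-congˡ (-‿inverseˡ τ) ⟩
      b * b * 0#            ≈⟨ zeroʳ _ ⟩
      0#                    ∎)
      where
      cs = m ℤ.* m ℤ.+ T ℤ.* (n ℤ.* n) ∷ ℤ.- (m ℤ.+ m) ∷ []
      a = ι R m; b = ι R n; τ = ι R T; u = a + b * s

    ∈ℤ[s]⇒inQuadField : ∀ {v} → v ∈ℤ[s] → InQuadField R s v
    ∈ℤ[s]⇒inQuadField {v} (m , n , v≈) =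
      + 1 , m , n , (λ ()) , trans (*-congʳ (+-identityʳ 1#)) (trans (*-identityˡ v) v≈)

module Regrouping {c ℓ : Level} (R : CommutativeRing c ℓ) where
  open CommutativeRing R
  open IntegerEmbedding R

  ξη-regroup : ∀ r α β d A B → r * α * A * (r * β * B) * d ≈ r * r * (d * (α * β)) * (A * B)
  ξη-regroup = solve 6 (λ r α β d A B → r :* α :* A :* (r :* β :* B) :* d
                                         := r :* r :* (d :* (α :* β)) :* (A :* B)) refl

  ξ³ξ-regroup : ∀ r α A B → cube R (r * α * A) * (r * α * B) ≈ r * r * (r * r) * pow4 R α * (cube R A * B)
  ξ³ξ-regroup = solve 4 (λ r α A B → r :* α :* A :* (r :* α :* A) :* (r :* α :* A) :* (r :* α :* B)
                                     := r :* r :* (r :* r) :* (α :* α :* α :* α) :* (A :* A :* A :* B)) refl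

lemma3p3 : ∀ {c ℓ : Level} (R : CommutativeRing c ℓ) →
  let open CommutativeRing R in
  CharZero R → NoZeroDivisors R →
  (t : ℕ) →
  (s r α β d : Carrier) →
  s * s ≈ - ι R (+ suc t) →
  r * r ≈ ι R (+ 2) →
  pow4 R α ≈ s + 1# →
  pow4 R β ≈ s - 1# →
  d * (α * β) ≈ 1# →
  (x₁ y₁ x₂ y₂ : ℤ) →
  let ξ₁ = r * α * (ι R x₁ - s * ι R y₁)
      ξ₂ = r * α * (ι R x₂ - s * ι R y₂)
      η₁ = r * β * (ι R x₁ + s * ι R y₁)
      η₂ = r * β * (ι R x₂ + s * ι R y₂)
      v₁ = ξ₁ * η₂ * d
      v₂ = cube R ξ₁ * ξ₂
      v₃ = cube R η₁ * η₂
  in (IsAlgebraicInteger R v₁ × InQuadField R s v₁)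
   × (IsAlgebraicInteger R v₂ × InQuadField R s v₂)
   × (IsAlgebraicInteger R v₃ × InQuadField R s v₃)
lemma3p3 R _ _ t s r α β d s²≈-T r²≈2 α⁴≈s+1 β⁴≈s-1 dαβ≈1 x₁ y₁ x₂ y₂ =
    integral (∈ℤ[s]-resp-≈ (sym (ξη-regroup r α β d _ _))
               (*-∈ℤ[s] (*-∈ℤ[s] r²∈ dαβ∈) (*-∈ℤ[s] (x-sy∈ x₁ y₁) (x+sy∈ x₂ y₂))))
  , integral (∈ℤ[s]-resp-≈ (sym (ξ³ξ-regroup r α _ _))
               (*-∈ℤ[s] (*-∈ℤ[s] (*-∈ℤ[s] r²∈ r²∈) α⁴∈) (*-∈ℤ[s] (cube-∈ (x-sy∈ x₁ y₁)) (x-sy∈ x₂ y₂))))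
  , integral (∈ℤ[s]-resp-≈ (sym (ξ³ξ-regroup r β _ _))
               (*-∈ℤ[s] (*-∈ℤ[s] (*-∈ℤ[s] r²∈ r²∈) β⁴∈) (*-∈ℤ[s] (cube-∈ (x+sy∈ x₁ y₁)) (x+sy∈ x₂ y₂))))
  where
  open CommutativeRing R
  open QuadraticOrder R t s s²≈-T
  open Regrouping R

  integral : ∀ {v} → v ∈ℤ[s] → IsAlgebraicInteger R v × InQuadField R s v
  integral v∈ = ∈ℤ[s]⇒isAlgebraicInteger v∈ , ∈ℤ[s]⇒inQuadField v∈

  cube-∈ : ∀ {v} → v ∈ℤ[s] → cube R v ∈ℤ[s]
  cube-∈ v∈ = *-∈ℤ[s] (*-∈ℤ[s] v∈ v∈) v∈

  x-sy∈ : ∀ x y → ι R x - s * ι R y ∈ℤ[s]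
  x-sy∈ x y = +-∈ℤ[s] (ι-∈ℤ[s] x) (-‿∈ℤ[s] (*-∈ℤ[s] s-∈ℤ[s] (ι-∈ℤ[s] y)))

  x+sy∈ : ∀ x y → ι R x + s * ι R y ∈ℤ[s]
  x+sy∈ x y = +-∈ℤ[s] (ι-∈ℤ[s] x) (*-∈ℤ[s] s-∈ℤ[s] (ι-∈ℤ[s] y))

  r²∈ : r * r ∈ℤ[s]
  r²∈ = ∈ℤ[s]-resp-≈ (sym r²≈2) (ι-∈ℤ[s] (+ 2))

  α⁴∈ : pow4 R α ∈ℤ[s]
  α⁴∈ = ∈ℤ[s]-resp-≈ (sym α⁴≈s+1) (+-∈ℤ[s] s-∈ℤ[s] 1#-∈ℤ[s])

  β⁴∈ : pow4 R β ∈ℤ[s]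
  β⁴∈ = ∈ℤ[s]-resp-≈ (sym β⁴≈s-1) (+-∈ℤ[s] s-∈ℤ[s] (-‿∈ℤ[s] 1#-∈ℤ[s]))

  dαβ∈ : d * (α * β) ∈ℤ[s]
  dαβ∈ = ∈ℤ[s]-resp-≈ (sym dαβ≈1) 1#-∈ℤ[s]
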